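{- Assume $q>2$. Let $m\in A=\mathbb{F}_q[T]$ have positive degree. Then $\Phi(m)\ge (q-1)\deg(m)$.
   Context: For $m\in A=\mathbb{F}_q[T]$ of positive degree, $\Phi(m)$ is the number of nonzero polynomials of degree less than $\deg(m)$ relatively prime to $m$; equivalently, if $m=\alpha\prod_i\wp_i^{s_i}$ with $\alpha\in\mathbb{F}_q^\times$ and distinct monic primes $\wp_i$, then $\Phi(m)=\prod_i(q^{\deg(\wp_i^{s_i})}-q^{\deg(\wp_i^{s_i-1})})$. -}

module Defs where

open import Level using (0ℓ)
open import Data.Nat using (ℕ; suc)
open import Data.List using (List; []; _∷_; map; length)
open import Data.Vec using (Vec; toList)
open import Data.Product using (Σ; ∃; _×_)
open import Data.List.Membership.Propositional using (_∈_)
open import Data.List.Relation.Unary.Unique.Propositional using (Unique)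
open import Data.Vec.Relation.Unary.Any using (Any)
open import Relation.Nullary using (¬_; yes; no)
open import Relation.Binary.Definitions using (DecidableEquality)
open import Relation.Binary.PropositionalEquality using (_≡_; _≢_)
open import Algebra.Structures using (IsCommutativeRing)

record FiniteField : Set₁ where
  field
    F        : Set
    _≟_      : DecidableEquality F
    _+_ _*_  : F → F → F
    -_       : F → F
    0# 1#    : F
    isCommutativeRing : IsCommutativeRing _≡_ _+_ _*_ -_ 0# 1#
    0≢1      : 0# ≢ 1#
    inverse  : ∀ x → x ≢ 0# → ∃ λ y → x * y ≡ 1#
    elements : List F
    complete : ∀ x → x ∈ elements
    unique   : Unique elements

  q : ℕ
  q = length elements

module Poly (K : FiniteField) where
  open FiniteField K

  -- Polynomials in A = F_q[T]: coefficient lists, lowest degree first.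
  -- Lists differing by trailing zeros represent the same polynomial.
  Pol : Set
  Pol = List F

  private
    cons : F → List F → List F
    cons x [] with x ≟ 0#
    ... | yes _ = []
    ... | no  _ = x ∷ []
    cons x (y ∷ ys) = x ∷ y ∷ ys

  strip : Pol → Pol
  strip []       = []
  strip (x ∷ xs) = cons x (strip xs)

  _≈_ : Pol → Pol → Set
  p ≈ r = strip p ≡ strip r

  addP : Pol → Pol → Pol
  addP []       ys       = ys
  addP (x ∷ xs) []       = x ∷ xs
  addP (x ∷ xs) (y ∷ ys) = (x + y) ∷ addP xs ys

  mulP : Pol → Pol → Pol
  mulP []       ys = []
  mulP (x ∷ xs) ys = addP (map (x *_) ys) (0# ∷ mulP xs ys)

  oneP : Pol
  oneP = 1# ∷ []

  _∣_ : Pol → Pol → Set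
  a ∣ b = ∃ λ c → mulP a c ≈ b

  IsUnit : Pol → Set
  IsUnit a = a ∣ oneP

  RelPrime : Pol → Pol → Set
  RelPrime a b = ∀ c → c ∣ a → c ∣ b → IsUnit c

  -- p has degree d (p nonzero, leading coefficient at index d)
  HasDegree : Pol → ℕ → Set
  HasDegree p d = length (strip p) ≡ suc d

  NonZeroV : ∀ {d} → Vec F d → Set
  NonZeroV v = Any (λ x → x ≢ 0#) v

  -- Polynomials of degree < d are represented (uniquely) by coefficient
  -- vectors of length d.  "Φ(m) = n" for m of degree d: there is a
  -- duplicate-free list of length n whose members are exactly the
  -- nonzero polynomials of degree < d relatively prime to m.
  PhiIs : (m : Pol) (d : ℕ) → HasDegree m d → ℕ → Set
  PhiIs m d _ n = Σ (List (Vec F d)) λ L →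
      Unique L × length L ≡ n ×
      (∀ v → (v ∈ L → NonZeroV v × RelPrime (toList v) m)
           × (NonZeroV v × RelPrime (toList v) m → v ∈ L))

module Submission where

-- We exhibit an explicit duplicate-free list of (q - 1)·d nonzero polynomials
-- of degree < d that are relatively prime to m (a "family" for m); the list
-- witnessing Φ(m) = n contains all such polynomials, so n is at least as
-- large.  Families are built by induction on d:
--
--  * if m(0) ≠ 0 (or d = 1), the monomials c·Tʲ with c ≠ 0 and j < d work:
--    a common divisor of c·Tʲ and m has nonzero constant term, so T can be
--    cancelled from it j times and it divides the unit c;
--  * if m(0) = 0 and d ≥ 2, write m = T·m′.  From a family for m′ we take
--    the polynomials f + μ·m′ with f in the family, μ ∈ F_q and
--    (f + μ·m′)(0) ≠ 0.  Each f excludes at most one μ, so we get at least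
--    (q - 1)·(q - 1)(d - 1) ≥ (q - 1)·d of them; this is where q > 2 is used.

open import Level using (0ℓ)
open import Defs
open import Data.Nat using (ℕ; zero; suc; _+_; _*_; _∸_; _≤_; _<_; z≤n; s≤s) renaming (_≟_ to _≟ℕ_)
open import Data.Nat.Properties
  using ( ≤-refl; ≤-trans; ≤-reflexive; suc-injective; _<?_; ≮⇒≥; <⇒≱; <⇒≤
        ; +-mono-≤; *-monoˡ-≤; *-monoʳ-≤; ∸-monoˡ-≤; *-assoc; *-comm; m≤m*n; m≤n+m∸n
        ; module ≤-Reasoning)
open import Data.List using (List; []; _∷_; _++_; map; length; filter; cartesianProduct; upTo)
open import Data.List.Properties using (length-++; length-map; filter-++; filter-all; length-removeAt′; length-upTo)
open import Data.List.Relation.Unary.Any using (here; there; index; _─_)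
open import Data.List.Relation.Unary.All as All using (All)
open import Data.List.Relation.Unary.AllPairs using (_∷_)
open import Data.List.Relation.Unary.Unique.Propositional using (Unique)
open import Data.List.Relation.Unary.Unique.Propositional.Properties using (map⁺; filter⁺; cartesianProduct⁺; upTo⁺)
open import Data.List.Membership.Propositional using (_∈_)
open import Data.List.Membership.Propositional.Properties using (∈-map⁻; ∈-filter⁻; ∈-cartesianProduct⁻; ∈-upTo⁻)
open import Data.Vec using (Vec; toList) renaming ([] to []ᵥ; _∷_ to _∷ᵥ_)
open import Data.Vec.Relation.Unary.Any using () renaming (here to hereᵥ; there to thereᵥ)
open import Data.Product using (_×_; _,_; proj₁; proj₂)
open import Data.Empty using (⊥; ⊥-elim)
open import Relation.Nullary using (¬_; yes; no)
open import Relation.Nullary.Decidable using (decidable-stable; ¬?)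
open import Relation.Unary using (Pred; Decidable)
open import Algebra.Bundles using (CommutativeRing)
import Algebra.Properties.Ring as RingProperties
import Algebra.Properties.CommutativeSemigroup as CommutativeSemigroupProperties
open import Relation.Binary.PropositionalEquality
  using (_≡_; _≢_; refl; sym; trans; cong; cong₂; subst; module ≡-Reasoning)

-- Counting with duplicate-free lists

module _ {A : Set} where

  ∈-─ : ∀ {x z : A} {ys} (x∈ys : x ∈ ys) → z ∈ ys → x ≢ z → z ∈ (ys ─ x∈ys)
  ∈-─ (here refl) (here refl)  x≢z = ⊥-elim (x≢z refl)
  ∈-─ (here refl) (there z∈ys) _   = z∈ys
  ∈-─ (there _)   (here refl)  _   = here refl
  ∈-─ (there x∈ys) (there z∈ys) x≢z = there (∈-─ x∈ys z∈ys x≢z)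

  unique-⊆⇒length≤ : ∀ {xs ys : List A} → Unique xs → (∀ {x} → x ∈ xs → x ∈ ys) →
                     length xs ≤ length ys
  unique-⊆⇒length≤ {[]}     _           _     = z≤n
  unique-⊆⇒length≤ {x ∷ xs} {ys} (x∉xs ∷ u) xs⊆ys =
    subst (suc (length xs) ≤_) (sym (length-removeAt′ ys (index x∈ys)))
      (s≤s (unique-⊆⇒length≤ u λ z∈xs →
              ∈-─ x∈ys (xs⊆ys (there z∈xs)) (All.lookup x∉xs z∈xs)))
    where x∈ys = xs⊆ys (here refl)

  map-injectiveOn⁺ : ∀ {B : Set} (f : A → B) {xs} → Unique xs →
                     (∀ {x y} → x ∈ xs → y ∈ xs → f x ≡ f y → x ≡ y) → Unique (map f xs)
  map-injectiveOn⁺ f {[]}     _          _   = Unique.[]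
  map-injectiveOn⁺ f {x ∷ xs} (x∉xs ∷ u) inj =
    All.tabulate (λ fy∈ fx≡fy → fresh fy∈ fx≡fy)
    ∷ map-injectiveOn⁺ f u (λ x∈ y∈ → inj (there x∈) (there y∈))
    where
      fresh : ∀ {z} → z ∈ map f xs → f x ≡ z → ⊥
      fresh z∈ fx≡z with ∈-map⁻ f z∈
      ... | y , y∈xs , refl = All.lookup x∉xs y∈xs (inj (here refl) (there y∈xs) fx≡z)

module _ {A : Set} {P : Pred A 0ℓ} (P? : Decidable P) where

  filter-atMostOneFailure : ∀ {xs} → Unique xs →
    (∀ {x y} → x ∈ xs → y ∈ xs → ¬ P x → ¬ P y → x ≡ y) →
    length xs ∸ 1 ≤ length (filter P? xs)
  filter-atMostOneFailure {[]}     _          _    = z≤n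
  filter-atMostOneFailure {x ∷ xs} (x∉xs ∷ u) once with P? x
  ... | yes _  = ≤-trans (m≤n+m∸n (length xs) 1)
                   (s≤s (filter-atMostOneFailure u λ x∈ y∈ → once (there x∈) (there y∈)))
  ... | no ¬px = ≤-reflexive (sym (cong length (filter-all P? restSatisfies)))
    where
      -- every other member passes, since a second failure would equal x
      restSatisfies : All P xs
      restSatisfies = All.tabulate λ {y} y∈xs → decidable-stable (P? y) λ ¬py →
        All.lookup x∉xs y∈xs (once (here refl) (there y∈xs) ¬px ¬py)

module _ {A B : Set} {P : Pred (A × B) 0ℓ} (P? : Decidable P) where

  filter-grid-count : ∀ xs {ys} → Unique ys →
    (∀ {x y y′} → x ∈ xs → y ∈ ys → y′ ∈ ys → ¬ P (x , y) → ¬ P (x , y′) → y ≡ y′) →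
    length xs * (length ys ∸ 1) ≤ length (filter P? (cartesianProduct xs ys))
  filter-grid-count []       _        _    = z≤n
  filter-grid-count (x ∷ xs) {ys} u once = begin
    (length ys ∸ 1) + length xs * (length ys ∸ 1)
      ≤⟨ +-mono-≤ rowCount (filter-grid-count xs u λ x∈ → once (there x∈)) ⟩
    length (filter P? row) + length (filter P? rest)
      ≡⟨ sym (length-++ (filter P? row)) ⟩
    length (filter P? row ++ filter P? rest)
      ≡⟨ cong length (sym (filter-++ P? row rest)) ⟩
    length (filter P? (row ++ rest)) ∎
    where
      open ≤-Reasoning
      row  = map (x ,_) ys
      rest = cartesianProduct xs ys

      rowOnce : ∀ {p p′} → p ∈ row → p′ ∈ row → ¬ P p → ¬ P p′ → p ≡ p′
      rowOnce p∈ p′∈ ¬Pp ¬Pp′ with ∈-map⁻ (x ,_) p∈ | ∈-map⁻ (x ,_) p′∈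
      ... | y , y∈ , refl | y′ , y′∈ , refl = cong (x ,_) (once (here refl) y∈ y′∈ ¬Pp ¬Pp′)

      rowCount : length ys ∸ 1 ≤ length (filter P? row)
      rowCount = subst (λ k → k ∸ 1 ≤ length (filter P? row)) (length-map (x ,_) ys)
                   (filter-atMostOneFailure P? (map⁺ (cong proj₂) u) rowOnce)

growth : ∀ {a} k → 2 ≤ a → a * suc (suc k) ≤ a * suc k * a
growth {a} k 2≤a = begin
  a * (2 + k)       ≤⟨ *-monoʳ-≤ a (s≤s (s≤s (m≤m*n k 2))) ⟩
  a * (suc k * 2)   ≡⟨ sym (*-assoc a (suc k) 2) ⟩
  a * suc k * 2     ≤⟨ *-monoʳ-≤ (a * suc k) 2≤a ⟩
  a * suc k * a     ∎
  where open ≤-Reasoning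

module _ (K : FiniteField) where

  open FiniteField K using (F; _≟_; 0≢1; inverse; q; elements; unique)
  open Poly K

  commutativeRing : CommutativeRing 0ℓ 0ℓ
  commutativeRing = record { isCommutativeRing = FiniteField.isCommutativeRing K }

  open CommutativeRing commutativeRing
    using (-_; 0#; 1#; +-assoc; +-identityˡ; +-identityʳ; -‿inverseʳ; *-identityˡ; zeroˡ; zeroʳ; distribˡ; distribʳ)
    renaming (_+_ to _⊕_; _*_ to _·_; *-comm to ·-comm; *-assoc to ·-assoc; *-identityʳ to ·-identityʳ)
  open RingProperties (CommutativeRing.ring commutativeRing) using (+-cancelˡ; +-cancelʳ)
  open CommutativeSemigroupProperties (CommutativeRing.+-commutativeSemigroup commutativeRing)
    using () renaming (interchange to ⊕-interchange; x∙yz≈y∙xz to ⊕-swapˡ)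
  open CommutativeSemigroupProperties (CommutativeRing.*-commutativeSemigroup commutativeRing)
    using () renaming (x∙yz≈y∙xz to ·-swapˡ)

  ·-cancelʳ : ∀ {a b c} → c ≢ 0# → a · c ≡ b · c → a ≡ b
  ·-cancelʳ {a} {b} {c} c≢0 ac≡bc = begin
    a               ≡⟨ sym (·-identityʳ a) ⟩
    a · 1#          ≡⟨ cong (a ·_) (sym cc⁻¹≡1) ⟩
    a · (c · c⁻¹)   ≡⟨ sym (·-assoc a c c⁻¹) ⟩
    (a · c) · c⁻¹   ≡⟨ cong (_· c⁻¹) ac≡bc ⟩
    (b · c) · c⁻¹   ≡⟨ ·-assoc b c c⁻¹ ⟩
    b · (c · c⁻¹)   ≡⟨ cong (b ·_) cc⁻¹≡1 ⟩
    b · 1#          ≡⟨ ·-identityʳ b ⟩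
    b               ∎
    where
      open ≡-Reasoning
      c⁻¹     = proj₁ (inverse c c≢0)
      cc⁻¹≡1  = proj₂ (inverse c c≢0)

  noZeroDivisors : ∀ {x y} → x ≢ 0# → x · y ≡ 0# → y ≡ 0#
  noZeroDivisors {x} {y} x≢0 xy≡0 = ·-cancelʳ x≢0 (trans (·-comm y x) (trans xy≡0 (sym (zeroˡ x))))

  affineRoot-unique : ∀ {a b μ μ′} → (b ≡ 0# → a ≢ 0#) →
                      a ⊕ μ · b ≡ 0# → a ⊕ μ′ · b ≡ 0# → μ ≡ μ′
  affineRoot-unique {a} {b} {μ} {μ′} b≡0⇒a≢0 root root′ with b ≟ 0#
  ... | yes b≡0 = ⊥-elim (b≡0⇒a≢0 b≡0 (begin
          a               ≡⟨ sym (+-identityʳ a) ⟩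
          a ⊕ 0#          ≡⟨ cong (a ⊕_) (sym (trans (cong (μ ·_) b≡0) (zeroʳ μ))) ⟩
          a ⊕ μ · b       ≡⟨ root ⟩
          0#              ∎))
    where open ≡-Reasoning
  ... | no b≢0 = ·-cancelʳ b≢0 (+-cancelˡ a (μ · b) (μ′ · b) (trans root (sym root′)))

  0+μ0≡0 : ∀ μ → 0# ⊕ μ · 0# ≡ 0#
  0+μ0≡0 μ = trans (cong (0# ⊕_) (zeroʳ μ)) (+-identityˡ 0#)

  regroup : ∀ x a μ b c d → x · (a ⊕ μ · b) ⊕ (c ⊕ μ · d) ≡ (x · a ⊕ c) ⊕ μ · (x · b ⊕ d)
  regroup x a μ b c d = begin
    x · (a ⊕ μ · b) ⊕ (c ⊕ μ · d)       ≡⟨ cong (_⊕ (c ⊕ μ · d)) (distribˡ x a (μ · b)) ⟩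
    (x · a ⊕ x · (μ · b)) ⊕ (c ⊕ μ · d) ≡⟨ ⊕-interchange (x · a) (x · (μ · b)) c (μ · d) ⟩
    (x · a ⊕ c) ⊕ (x · (μ · b) ⊕ μ · d) ≡⟨ cong (λ t → (x · a ⊕ c) ⊕ (t ⊕ μ · d)) (·-swapˡ x μ b) ⟩
    (x · a ⊕ c) ⊕ (μ · (x · b) ⊕ μ · d) ≡⟨ cong ((x · a ⊕ c) ⊕_) (sym (distribˡ μ (x · b) d)) ⟩
    (x · a ⊕ c) ⊕ μ · (x · b ⊕ d)       ∎
    where open ≡-Reasoning

  cancelMultiple : ∀ a μ c → (a ⊕ μ · c) ⊕ (- μ) · c ≡ a
  cancelMultiple a μ c = begin
    (a ⊕ μ · c) ⊕ (- μ) · c   ≡⟨ +-assoc a (μ · c) ((- μ) · c) ⟩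
    a ⊕ (μ · c ⊕ (- μ) · c)   ≡⟨ cong (a ⊕_) (sym (distribʳ c μ (- μ))) ⟩
    a ⊕ (μ ⊕ - μ) · c         ≡⟨ cong (λ z → a ⊕ z · c) (-‿inverseʳ μ) ⟩
    a ⊕ 0# · c                ≡⟨ cong (a ⊕_) (zeroˡ c) ⟩
    a ⊕ 0#                    ≡⟨ +-identityʳ a ⟩
    a                         ∎
    where open ≡-Reasoning

  -- Coefficients of polynomials

  co : Pol → ℕ → F
  co []       _       = 0#
  co (x ∷ xs) zero    = x
  co (x ∷ xs) (suc i) = co xs i

  -- Coefficientwise equality, which is easier to work with than _≈_.
  infix 4 _~_
  _~_ : Pol → Pol → Set
  p ~ r = ∀ i → co p i ≡ co r i

  shift : Pol → Pol
  shift p = 0# ∷ p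

  scale : F → Pol → Pol
  scale μ = map (μ ·_)

  monomial : F → ℕ → Pol
  monomial c zero    = c ∷ []
  monomial c (suc j) = shift (monomial c j)

  -- The coefficients of p shifted down by one, i.e. (p - p(0))/T.
  tl : Pol → Pol
  tl []       = []
  tl (x ∷ xs) = xs

  co-tl : ∀ p i → co (tl p) i ≡ co p (suc i)
  co-tl []       i = refl
  co-tl (x ∷ xs) i = refl

  ~shift-tl : ∀ {p} → co p 0 ≡ 0# → p ~ shift (tl p)
  ~shift-tl p0≡0 zero    = p0≡0
  ~shift-tl {p}  _ (suc i) = sym (co-tl p i)

  shift-cong : ∀ {p r} → p ~ r → shift p ~ shift r
  shift-cong p~r zero    = refl
  shift-cong p~r (suc i) = p~r i

  co-shift[] : ∀ i → co (shift []) i ≡ 0#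
  co-shift[] zero    = refl
  co-shift[] (suc i) = refl

  co-strip : ∀ p → strip p ~ p
  co-strip []       i = refl
  co-strip (x ∷ xs) i with strip xs | co-strip xs
  ... | y ∷ ys | ih = cong-cons i
    where cong-cons : ∀ i → co (x ∷ y ∷ ys) i ≡ co (x ∷ xs) i
          cong-cons zero    = refl
          cong-cons (suc i) = ih i
  ... | [] | ih with x ≟ 0#
  co-strip (x ∷ xs) zero    | [] | ih | yes x≡0 = sym x≡0
  co-strip (x ∷ xs) (suc i) | [] | ih | yes _   = ih i
  co-strip (x ∷ xs) zero    | [] | ih | no _    = refl
  co-strip (x ∷ xs) (suc i) | [] | ih | no _    = ih i

  ≈⇒~ : ∀ p r → p ≈ r → p ~ r
  ≈⇒~ p r p≈r i = trans (sym (co-strip p i)) (trans (cong (λ s → co s i) p≈r) (co-strip r i))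

  ~⇒≈ : ∀ p r → p ~ r → p ≈ r
  ~⇒≈ []       []       _   = refl
  ~⇒≈ []       (y ∷ ys) p~r with ~⇒≈ [] ys (λ i → p~r (suc i))
  ... | []≈ys rewrite sym []≈ys with y ≟ 0#
  ...   | yes _   = refl
  ...   | no y≢0  = ⊥-elim (y≢0 (sym (p~r 0)))
  ~⇒≈ (x ∷ xs) []       p~r with ~⇒≈ xs [] (λ i → p~r (suc i))
  ... | xs≈[] rewrite xs≈[] with x ≟ 0#
  ...   | yes _   = refl
  ...   | no x≢0  = ⊥-elim (x≢0 (p~r 0))
  ~⇒≈ (x ∷ xs) (y ∷ ys) p~r with p~r 0 | ~⇒≈ xs ys (λ i → p~r (suc i))
  ... | refl | xs≈ys rewrite xs≈ys = refl

  co-addP : ∀ p r i → co (addP p r) i ≡ co p i ⊕ co r i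
  co-addP []       r        i       = sym (+-identityˡ _)
  co-addP (x ∷ xs) []       zero    = sym (+-identityʳ x)
  co-addP (x ∷ xs) []       (suc i) = sym (+-identityʳ _)
  co-addP (x ∷ xs) (y ∷ ys) zero    = refl
  co-addP (x ∷ xs) (y ∷ ys) (suc i) = co-addP xs ys i

  co-scale : ∀ μ p i → co (scale μ p) i ≡ μ · co p i
  co-scale μ []       i       = sym (zeroʳ μ)
  co-scale μ (x ∷ xs) zero    = refl
  co-scale μ (x ∷ xs) (suc i) = co-scale μ xs i

  co-lincomb : ∀ p μ r i → co (addP p (scale μ r)) i ≡ co p i ⊕ μ · co r i
  co-lincomb p μ r i = trans (co-addP p (scale μ r) i) (cong (co p i ⊕_) (co-scale μ r i))

  co-mulP-cons : ∀ x xs k i → co (mulP (x ∷ xs) k) i ≡ x · co k i ⊕ co (shift (mulP xs k)) i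
  co-mulP-cons x xs k i = trans (co-addP (scale x k) (shift (mulP xs k)) i) (cong (_⊕ _) (co-scale x k i))

  co-mulP0 : ∀ e k → co (mulP e k) 0 ≡ co e 0 · co k 0
  co-mulP0 []       k = sym (zeroˡ (co k 0))
  co-mulP0 (x ∷ xs) k = trans (co-mulP-cons x xs k 0) (+-identityʳ _)

  mulP-zeroʳ : ∀ e i → co (mulP e []) i ≡ 0#
  mulP-zeroʳ []       i       = refl
  mulP-zeroʳ (x ∷ xs) zero    = refl
  mulP-zeroʳ (x ∷ xs) (suc i) = mulP-zeroʳ xs i

  mulP-consʳ : ∀ e x k j → co (mulP e (x ∷ k)) j ≡ co e j · x ⊕ co (shift (mulP e k)) j
  mulP-consʳ []       x k j       = sym (trans (cong₂ _⊕_ (zeroˡ x) (co-shift[] j)) (+-identityˡ 0#))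
  mulP-consʳ (a ∷ es) x k zero    = refl
  mulP-consʳ (a ∷ es) x k (suc j) = begin
    co (mulP (a ∷ es) (x ∷ k)) (suc j)                         ≡⟨ co-mulP-cons a es (x ∷ k) (suc j) ⟩
    a · co k j ⊕ co (mulP es (x ∷ k)) j                        ≡⟨ cong (a · co k j ⊕_) (mulP-consʳ es x k j) ⟩
    a · co k j ⊕ (co es j · x ⊕ co (shift (mulP es k)) j)      ≡⟨ ⊕-swapˡ _ _ _ ⟩
    co es j · x ⊕ (a · co k j ⊕ co (shift (mulP es k)) j)      ≡⟨ cong (co es j · x ⊕_) (sym (co-mulP-cons a es k j)) ⟩
    co es j · x ⊕ co (mulP (a ∷ es) k) j                       ∎
    where open ≡-Reasoning

  mulP-linearʳ : ∀ e k₁ μ k₂ i →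
    co (mulP e (addP k₁ (scale μ k₂))) i ≡ co (mulP e k₁) i ⊕ μ · co (mulP e k₂) i
  mulP-linearʳ []       k₁ μ k₂ i = sym (0+μ0≡0 μ)
  mulP-linearʳ (x ∷ xs) k₁ μ k₂ i = begin
    co (mulP (x ∷ xs) k) i
      ≡⟨ co-mulP-cons x xs k i ⟩
    x · co k i ⊕ co (shift (mulP xs k)) i
      ≡⟨ cong₂ (λ a b → x · a ⊕ b) (co-lincomb k₁ μ k₂ i) (shifted i) ⟩
    x · (co k₁ i ⊕ μ · co k₂ i) ⊕ (co (shift (mulP xs k₁)) i ⊕ μ · co (shift (mulP xs k₂)) i)
      ≡⟨ regroup _ _ _ _ _ _ ⟩
    (x · co k₁ i ⊕ co (shift (mulP xs k₁)) i) ⊕ μ · (x · co k₂ i ⊕ co (shift (mulP xs k₂)) i)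
      ≡⟨ sym (cong₂ (λ a b → a ⊕ μ · b) (co-mulP-cons x xs k₁ i) (co-mulP-cons x xs k₂ i)) ⟩
    co (mulP (x ∷ xs) k₁) i ⊕ μ · co (mulP (x ∷ xs) k₂) i ∎
    where
      open ≡-Reasoning
      k = addP k₁ (scale μ k₂)
      shifted : ∀ i → co (shift (mulP xs k)) i ≡ co (shift (mulP xs k₁)) i ⊕ μ · co (shift (mulP xs k₂)) i
      shifted zero    = sym (0+μ0≡0 μ)
      shifted (suc i) = mulP-linearʳ xs k₁ μ k₂ i

  mulP-shiftˡ : ∀ e k → mulP (shift e) k ~ shift (mulP e k)
  mulP-shiftˡ e k i = trans (co-mulP-cons 0# e k i)
    (trans (cong (_⊕ co (shift (mulP e k)) i) (zeroˡ (co k i))) (+-identityˡ _))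

  mulP-oneˡ : ∀ k → mulP oneP k ~ k
  mulP-oneˡ k i = trans (co-mulP-cons 1# [] k i)
    (trans (cong₂ _⊕_ (*-identityˡ (co k i)) (co-shift[] i)) (+-identityʳ (co k i)))

  co-monomial-same : ∀ c j → co (monomial c j) j ≡ c
  co-monomial-same c zero    = refl
  co-monomial-same c (suc j) = co-monomial-same c j

  co-monomial-other : ∀ c j i → i ≢ j → co (monomial c j) i ≡ 0#
  co-monomial-other c zero    zero    i≢j = ⊥-elim (i≢j refl)
  co-monomial-other c zero    (suc i) _   = refl
  co-monomial-other c (suc j) zero    _   = refl
  co-monomial-other c (suc j) (suc i) i≢j = co-monomial-other c j i (λ i≡j → i≢j (cong suc i≡j))

  -- Divisibility

  record _∣~_ (e p : Pol) : Set where
    constructor divides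
    field
      quotient   : Pol
      quotient-eq : mulP e quotient ~ p

  ∣⇒∣~ : ∀ e p → e ∣ p → e ∣~ p
  ∣⇒∣~ e p (k , ek≈p) = divides k (≈⇒~ (mulP e k) p ek≈p)

  ∣~⇒∣ : ∀ e p → e ∣~ p → e ∣ p
  ∣~⇒∣ e p (divides k ek~p) = k , ~⇒≈ (mulP e k) p ek~p

  ∣~-respʳ : ∀ {e p p′} → e ∣~ p → p ~ p′ → e ∣~ p′
  ∣~-respʳ (divides k ek~p) p~p′ = divides k λ i → trans (ek~p i) (p~p′ i)

  ∣~-lincomb : ∀ {e p r} → e ∣~ p → e ∣~ r → ∀ μ → e ∣~ addP p (scale μ r)
  ∣~-lincomb {e} {p} {r} (divides k₁ ek₁~p) (divides k₂ ek₂~r) μ = divides (addP k₁ (scale μ k₂)) λ i → begin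
    co (mulP e (addP k₁ (scale μ k₂))) i    ≡⟨ mulP-linearʳ e k₁ μ k₂ i ⟩
    co (mulP e k₁) i ⊕ μ · co (mulP e k₂) i  ≡⟨ cong₂ (λ a b → a ⊕ μ · b) (ek₁~p i) (ek₂~r i) ⟩
    co p i ⊕ μ · co r i                      ≡⟨ sym (co-lincomb p μ r i) ⟩
    co (addP p (scale μ r)) i               ∎
    where open ≡-Reasoning

  ∣~-constTerm : ∀ {e g} → e ∣~ g → co g 0 ≢ 0# → co e 0 ≢ 0#
  ∣~-constTerm {e} {g} (divides k ek~g) g0≢0 e0≡0 = g0≢0 (begin
    co g 0             ≡⟨ sym (ek~g 0) ⟩
    co (mulP e k) 0    ≡⟨ co-mulP0 e k ⟩
    co e 0 · co k 0    ≡⟨ cong (_· co k 0) e0≡0 ⟩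
    0# · co k 0        ≡⟨ zeroˡ (co k 0) ⟩
    0#                 ∎)
    where open ≡-Reasoning

  -- If e(0) ≠ 0 then e ∣ T·h implies e ∣ h: the cofactor must be divisible by T.
  ∣~-cancelT : ∀ {e h} → co e 0 ≢ 0# → e ∣~ shift h → e ∣~ h
  ∣~-cancelT {e} {h} _ (divides [] e0~Th) = divides [] λ i →
    trans (mulP-zeroʳ e i) (trans (sym (mulP-zeroʳ e (suc i))) (e0~Th (suc i)))
  ∣~-cancelT {e} {h} e0≢0 (divides (x ∷ k) ek~Th) = divides k λ i → begin
    co (mulP e k) i                      ≡⟨ sym (+-identityˡ _) ⟩
    0# ⊕ co (mulP e k) i                 ≡⟨ cong (_⊕ co (mulP e k) i) (sym (zeroʳ (co e (suc i)))) ⟩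
    co e (suc i) · 0# ⊕ co (mulP e k) i  ≡⟨ cong (λ y → co e (suc i) · y ⊕ co (mulP e k) i) (sym x≡0) ⟩
    co e (suc i) · x ⊕ co (mulP e k) i   ≡⟨ sym (mulP-consʳ e x k (suc i)) ⟩
    co (mulP e (x ∷ k)) (suc i)          ≡⟨ ek~Th (suc i) ⟩
    co h i                               ∎
    where
      open ≡-Reasoning
      x≡0 : x ≡ 0#
      x≡0 = noZeroDivisors e0≢0 (trans (sym (co-mulP0 e (x ∷ k))) (ek~Th 0))

  ∣~-const⇒unit : ∀ {e c} → c ≢ 0# → e ∣~ (c ∷ []) → IsUnit e
  ∣~-const⇒unit {e} {c} c≢0 (divides k ek~c) = ∣~⇒∣ e oneP (divides (scale c⁻¹ k) λ i → begin
    co (mulP e (scale c⁻¹ k)) i            ≡⟨ mulP-linearʳ e [] c⁻¹ k i ⟩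
    co (mulP e []) i ⊕ c⁻¹ · co (mulP e k) i ≡⟨ cong₂ (λ a b → a ⊕ c⁻¹ · b) (mulP-zeroʳ e i) (ek~c i) ⟩
    0# ⊕ c⁻¹ · co (c ∷ []) i               ≡⟨ +-identityˡ _ ⟩
    c⁻¹ · co (c ∷ []) i                     ≡⟨ sym (co-scale c⁻¹ (c ∷ []) i) ⟩
    co (scale c⁻¹ (c ∷ [])) i              ≡⟨ c⁻¹c≡1 i ⟩
    co oneP i                              ∎)
    where
      open ≡-Reasoning
      c⁻¹ = proj₁ (inverse c c≢0)
      c⁻¹c≡1 : scale c⁻¹ (c ∷ []) ~ oneP
      c⁻¹c≡1 zero    = trans (·-comm c⁻¹ c) (proj₂ (inverse c c≢0))
      c⁻¹c≡1 (suc i) = refl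

  T : Pol
  T = shift oneP

  T∣~ : ∀ {p} → co p 0 ≡ 0# → T ∣~ p
  T∣~ {p} p0≡0 = divides (tl p) λ i → begin
    co (mulP T (tl p)) i             ≡⟨ mulP-shiftˡ oneP (tl p) i ⟩
    co (shift (mulP oneP (tl p))) i  ≡⟨ shift-cong (mulP-oneˡ (tl p)) i ⟩
    co (shift (tl p)) i              ≡⟨ sym (~shift-tl {p} p0≡0 i) ⟩
    co p i                           ∎
    where open ≡-Reasoning

  T-nonunit : ¬ IsUnit T
  T-nonunit T∣1 = ∣~-constTerm (∣⇒∣~ T oneP T∣1) (λ 1≡0 → 0≢1 (sym 1≡0)) refl

  -- Relative primality

  relPrime-respˡ : ∀ {a a′ m} → RelPrime a m → a ~ a′ → RelPrime a′ m
  relPrime-respˡ {a} {a′} rp a~a′ e e∣a′ e∣m =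
    rp e (∣~⇒∣ e a (∣~-respʳ (∣⇒∣~ e a′ e∣a′) (λ i → sym (a~a′ i)))) e∣m

  ∣~-monomial⇒∣~-const : ∀ {e c} j → co e 0 ≢ 0# → e ∣~ monomial c j → e ∣~ (c ∷ [])
  ∣~-monomial⇒∣~-const zero    _    e∣c   = e∣c
  ∣~-monomial⇒∣~-const (suc j) e0≢0 e∣cTʲ = ∣~-monomial⇒∣~-const j e0≢0 (∣~-cancelT e0≢0 e∣cTʲ)

  relPrime-const : ∀ {c m} → c ≢ 0# → RelPrime (c ∷ []) m
  relPrime-const {c} c≢0 e e∣c _ = ∣~-const⇒unit c≢0 (∣⇒∣~ e (c ∷ []) e∣c)

  relPrime-monomial : ∀ {c m} j → c ≢ 0# → co m 0 ≢ 0# → RelPrime (monomial c j) m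
  relPrime-monomial {c} {m} j c≢0 m0≢0 e e∣cTʲ e∣m = ∣~-const⇒unit c≢0
    (∣~-monomial⇒∣~-const j (∣~-constTerm (∣⇒∣~ e m e∣m) m0≢0) (∣⇒∣~ e (monomial c j) e∣cTʲ))

  -- If m(0) = 0, every f prime to m has f(0) ≠ 0, as otherwise T divides both.
  relPrime-constTerm : ∀ {f m} → RelPrime f m → co m 0 ≡ 0# → co f 0 ≢ 0#
  relPrime-constTerm {f} {m} rp m0≡0 f0≡0 =
    T-nonunit (rp T (∣~⇒∣ T f (T∣~ f0≡0)) (∣~⇒∣ T m (T∣~ m0≡0)))

  -- If f is prime to m′ and g = f + μ·m′ has g(0) ≠ 0, then g is prime to
  -- m = T·m′: a common divisor e has e(0) ≠ 0, so it divides m′, hence f.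
  relPrime-lincomb-shift : ∀ {f m m′} μ → m ~ shift m′ → RelPrime f m′ →
    co (addP f (scale μ m′)) 0 ≢ 0# → RelPrime (addP f (scale μ m′)) m
  relPrime-lincomb-shift {f} {m} {m′} μ m~Tm′ f⊥m′ g0≢0 e e∣g e∣m =
    f⊥m′ e (∣~⇒∣ e f e∣f) (∣~⇒∣ e m′ e∣m′)
    where
      open ≡-Reasoning
      g : Pol
      g = addP f (scale μ m′)
      e∣~g : e ∣~ g
      e∣~g = ∣⇒∣~ e g e∣g
      e∣m′ : e ∣~ m′
      e∣m′ = ∣~-cancelT (∣~-constTerm e∣~g g0≢0) (∣~-respʳ (∣⇒∣~ e m e∣m) m~Tm′)
      g-μm′~f : addP g (scale (- μ) m′) ~ f
      g-μm′~f i = begin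
        co (addP g (scale (- μ) m′)) i            ≡⟨ co-lincomb g (- μ) m′ i ⟩
        co g i ⊕ (- μ) · co m′ i                  ≡⟨ cong (_⊕ (- μ) · co m′ i) (co-lincomb f μ m′ i) ⟩
        (co f i ⊕ μ · co m′ i) ⊕ (- μ) · co m′ i  ≡⟨ cancelMultiple (co f i) μ (co m′ i) ⟩
        co f i                                    ∎
      e∣f : e ∣~ f
      e∣f = ∣~-respʳ (∣~-lincomb e∣~g e∣m′ (- μ)) g-μm′~f

  -- Degrees

  record Deg (m : Pol) (d : ℕ) : Set where
    constructor degree
    field
      leading≢0 : co m d ≢ 0#
      above≡0   : ∀ i → d < i → co m i ≡ 0#

  co-≥length : ∀ p i → length p ≤ i → co p i ≡ 0#
  co-≥length []       i       _         = refl
  co-≥length (x ∷ xs) (suc i) (s≤s len≤i) = co-≥length xs i len≤i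

  HasDegree⇒leading≢0 : ∀ p d → HasDegree p d → co p d ≢ 0#
  HasDegree⇒leading≢0 []       d ()
  HasDegree⇒leading≢0 (x ∷ xs) d hd with strip xs in eq
  HasDegree⇒leading≢0 (x ∷ xs) d hd | [] with x ≟ 0#
  HasDegree⇒leading≢0 (x ∷ xs) d () | [] | yes _
  HasDegree⇒leading≢0 (x ∷ xs) zero    hd | [] | no x≢0 = x≢0
  HasDegree⇒leading≢0 (x ∷ xs) (suc d) () | [] | no _
  HasDegree⇒leading≢0 (x ∷ xs) zero    () | _ ∷ _
  HasDegree⇒leading≢0 (x ∷ xs) (suc d) hd | _ ∷ _ =
    HasDegree⇒leading≢0 xs d (trans (cong length eq) (suc-injective hd))

  HasDegree⇒Deg : ∀ p d → HasDegree p d → Deg p d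
  HasDegree⇒Deg p d hd = degree (HasDegree⇒leading≢0 p d hd) λ i d<i →
    trans (sym (co-strip p i)) (co-≥length (strip p) i (subst (_≤ i) (sym hd) d<i))

  Deg-tl : ∀ {m d} → Deg m (suc d) → Deg (tl m) d
  Deg-tl {m} {d} (degree lead≢0 high≡0) = degree
    (λ lead≡0 → lead≢0 (trans (sym (co-tl m d)) lead≡0))
    λ i d<i → trans (co-tl m i) (high≡0 (suc i) (s≤s d<i))

  toVec : (d : ℕ) → Pol → Vec F d
  toVec zero    p = []ᵥ
  toVec (suc d) p = co p 0 ∷ᵥ toVec d (tl p)

  co-toList-≥ : ∀ {d} (v : Vec F d) i → d ≤ i → co (toList v) i ≡ 0#
  co-toList-≥ []ᵥ       i       _       = refl
  co-toList-≥ (x ∷ᵥ v) (suc i) (s≤s d≤i) = co-toList-≥ v i d≤i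

  co-toVec : ∀ d p i → i < d → co (toList (toVec d p)) i ≡ co p i
  co-toVec (suc d) p zero    _         = refl
  co-toVec (suc d) p (suc i) (s≤s i<d) = trans (co-toVec d (tl p) i i<d) (co-tl p i)

  toVec-~ : ∀ d p → (∀ i → d ≤ i → co p i ≡ 0#) → toList (toVec d p) ~ p
  toVec-~ d p high≡0 i with i <? d
  ... | yes i<d = co-toVec d p i i<d
  ... | no  i≮d = trans (co-toList-≥ (toVec d p) i (≮⇒≥ i≮d)) (sym (high≡0 i (≮⇒≥ i≮d)))

  toList-injective : ∀ {d} (v w : Vec F d) → toList v ~ toList w → v ≡ w
  toList-injective []ᵥ       []ᵥ       _   = refl
  toList-injective (x ∷ᵥ v) (y ∷ᵥ w) v~w = cong₂ _∷ᵥ_ (v~w 0) (toList-injective v w (λ i → v~w (suc i)))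

  sameVector⇒~ : ∀ {d} {v w : Vec F d} p r → toList v ~ p → toList w ~ r → v ≡ w → p ~ r
  sameVector⇒~ p r v~p w~r refl i = trans (sym (v~p i)) (w~r i)

  nonZeroV : ∀ {d} (v : Vec F d) i → co (toList v) i ≢ 0# → NonZeroV v
  nonZeroV []ᵥ       i       vᵢ≢0 = ⊥-elim (vᵢ≢0 refl)
  nonZeroV (x ∷ᵥ v) zero    x≢0  = hereᵥ x≢0
  nonZeroV (x ∷ᵥ v) (suc i) vᵢ≢0 = thereᵥ (nonZeroV v i vᵢ≢0)

  -- For deg m′ = n, the map (f, μ) ↦ f + μ·m′ on vectors f of length n is
  -- injective: the coefficient at n recovers μ, the lower ones f.
  lincomb-injective : ∀ {m′ n} → Deg m′ n → (f f′ : Vec F n) (μ μ′ : F) →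
    addP (toList f) (scale μ m′) ~ addP (toList f′) (scale μ′ m′) → f ≡ f′ × μ ≡ μ′
  lincomb-injective {m′} {n} (degree lead≢0 _) f f′ μ μ′ g~g′ = f≡f′ , μ≡μ′
    where
      coeff : ∀ i → co (toList f) i ⊕ μ · co m′ i ≡ co (toList f′) i ⊕ μ′ · co m′ i
      coeff i = trans (sym (co-lincomb (toList f) μ m′ i)) (trans (g~g′ i) (co-lincomb (toList f′) μ′ m′ i))
      μ≡μ′ : μ ≡ μ′
      μ≡μ′ = ·-cancelʳ lead≢0 (begin
        μ · co m′ n                       ≡⟨ sym (+-identityˡ _) ⟩
        0# ⊕ μ · co m′ n                  ≡⟨ cong (_⊕ μ · co m′ n) (sym (co-toList-≥ f n ≤-refl)) ⟩
        co (toList f) n ⊕ μ · co m′ n     ≡⟨ coeff n ⟩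
        co (toList f′) n ⊕ μ′ · co m′ n   ≡⟨ cong (_⊕ μ′ · co m′ n) (co-toList-≥ f′ n ≤-refl) ⟩
        0# ⊕ μ′ · co m′ n                 ≡⟨ +-identityˡ _ ⟩
        μ′ · co m′ n                      ∎)
        where open ≡-Reasoning
      f≡f′ : f ≡ f′
      f≡f′ = toList-injective f f′ λ i →
        +-cancelʳ (μ · co m′ i) _ _ (trans (coeff i) (cong (λ ν → co (toList f′) i ⊕ ν · co m′ i) (sym μ≡μ′)))

  -- Families of polynomials prime to m

  record Family (m : Pol) (d : ℕ) : Set where
    field
      members  : List (Vec F d)
      distinct : Unique members
      good     : ∀ {v} → v ∈ members → NonZeroV v × RelPrime (toList v) m
      large    : (q ∸ 1) * d ≤ length members

  monomialFamily : ∀ {m} d → (∀ {c} j → c ≢ 0# → j < d → RelPrime (monomial c j) m) → Family m d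
  monomialFamily {m} d prime = record
    { members  = map vec pairs
    ; distinct = map-injectiveOn⁺ vec (filter⁺ nonzero? (cartesianProduct⁺ (upTo⁺ d) unique)) injective
    ; good     = good
    ; large    = large
    }
    where
      Nonzero : Pred (ℕ × F) 0ℓ
      Nonzero (j , c) = c ≢ 0#

      nonzero? : Decidable Nonzero
      nonzero? (j , c) = ¬? (c ≟ 0#)

      pairs : List (ℕ × F)
      pairs = filter nonzero? (cartesianProduct (upTo d) elements)

      vec : ℕ × F → Vec F d
      vec (j , c) = toVec d (monomial c j)

      pair∈ : ∀ {j c} → (j , c) ∈ pairs → j < d × c ≢ 0#
      pair∈ jc∈ with ∈-filter⁻ nonzero? jc∈
      ... | jc∈grid , c≢0 = ∈-upTo⁻ (proj₁ (∈-cartesianProduct⁻ (upTo d) elements jc∈grid)) , c≢0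

      vec~ : ∀ {j} c → j < d → toList (vec (j , c)) ~ monomial c j
      vec~ {j} c j<d = toVec-~ d (monomial c j) λ i d≤i →
        co-monomial-other c j i (λ i≡j → <⇒≱ j<d (subst (d ≤_) i≡j d≤i))

      monomials~ : ∀ {j j′ c c′} → (j , c) ∈ pairs → (j′ , c′) ∈ pairs →
                   vec (j , c) ≡ vec (j′ , c′) → monomial c j ~ monomial c′ j′
      monomials~ {j} {j′} {c} {c′} x∈ y∈ = sameVector⇒~ (monomial c j) (monomial c′ j′)
        (vec~ c (proj₁ (pair∈ x∈))) (vec~ c′ (proj₁ (pair∈ y∈)))

      injective : ∀ {x y} → x ∈ pairs → y ∈ pairs → vec x ≡ vec y → x ≡ y
      -- compare the coefficients at j: it is c on the left, and c′ or 0 on the right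
      injective {j , c} {j′ , c′} x∈ y∈ vx≡vy with j ≟ℕ j′
      ... | yes refl = cong (j ,_) (trans cⱼ (co-monomial-same c′ j))
        where cⱼ = trans (sym (co-monomial-same c j)) (monomials~ x∈ y∈ vx≡vy j)
      ... | no j≢j′  = ⊥-elim (proj₂ (pair∈ x∈) (trans cⱼ (co-monomial-other c′ j′ j j≢j′)))
        where cⱼ = trans (sym (co-monomial-same c j)) (monomials~ x∈ y∈ vx≡vy j)

      oneZeroPerRow : ∀ {j c c′} → j ∈ upTo d → c ∈ elements → c′ ∈ elements →
                 ¬ Nonzero (j , c) → ¬ Nonzero (j , c′) → c ≡ c′
      oneZeroPerRow {c = c} {c′} _ _ _ ¬c≢0 ¬c′≢0 =
        trans (decidable-stable (c ≟ 0#) ¬c≢0) (sym (decidable-stable (c′ ≟ 0#) ¬c′≢0))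

      good : ∀ {v} → v ∈ map vec pairs → NonZeroV v × RelPrime (toList v) m
      good v∈ with ∈-map⁻ vec v∈
      ... | (j , c) , jc∈ , refl with pair∈ jc∈
      ... | j<d , c≢0 =
        nonZeroV (vec (j , c)) j
          (λ vⱼ≡0 → c≢0 (trans (sym (co-monomial-same c j)) (trans (sym (vec~ c j<d j)) vⱼ≡0))) ,
        relPrime-respˡ {monomial c j} {toList (vec (j , c))} {m}
          (prime j c≢0 j<d) (λ i → sym (vec~ c j<d i))

      large : (q ∸ 1) * d ≤ length (map vec pairs)
      large = begin
        (q ∸ 1) * d                ≡⟨ *-comm (q ∸ 1) d ⟩
        d * (q ∸ 1)                ≡⟨ cong (_* (q ∸ 1)) (sym (length-upTo d)) ⟩
        length (upTo d) * (q ∸ 1)  ≤⟨ filter-grid-count nonzero? (upTo d) unique oneZeroPerRow ⟩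
        length pairs               ≡⟨ sym (length-map vec pairs) ⟩
        length (map vec pairs)     ∎
        where open ≤-Reasoning

  -- If m = T·m′ has degree d + 2 and q > 2, a family for m′ of length d + 1
  -- yields a family for m: the vectors of f + μ·m′ for f in the family and
  -- μ ∈ F with (f + μ·m′)(0) ≠ 0.  Each f excludes at most one μ, so there
  -- are at least (q - 1)·(q - 1)(d + 1) ≥ (q - 1)(d + 2) of them.
  liftFamily : 2 < q → ∀ {m d} → Deg m (2 + d) → co m 0 ≡ 0# →
               Family (tl m) (suc d) → Family m (2 + d)
  liftFamily q>2 {m} {d} deg m0≡0 family′ = record
    { members  = map vec pairs
    ; distinct = map⁺ injective (filter⁺ admissible? (cartesianProduct⁺ (Family.distinct family′) unique))
    ; good     = good
    ; large    = large
    }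
    where
      open Family family′ using () renaming (members to L′; good to good′)

      m′ : Pol
      m′ = tl m

      deg′ : Deg m′ (suc d)
      deg′ = Deg-tl deg

      lift : Vec F (suc d) × F → Pol
      lift (f , μ) = addP (toList f) (scale μ m′)

      Admissible : Pred (Vec F (suc d) × F) 0ℓ
      Admissible fμ = co (lift fμ) 0 ≢ 0#

      admissible? : Decidable Admissible
      admissible? fμ = ¬? (co (lift fμ) 0 ≟ 0#)

      pairs : List (Vec F (suc d) × F)
      pairs = filter admissible? (cartesianProduct L′ elements)

      vec : Vec F (suc d) × F → Vec F (2 + d)
      vec fμ = toVec (2 + d) (lift fμ)

      -- f + μ·m′ has degree < d + 2, so vec loses no coefficients
      vec~ : ∀ fμ → toList (vec fμ) ~ lift fμ
      vec~ (f , μ) = toVec-~ (2 + d) (lift (f , μ)) λ i 2+d≤i → begin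
        co (lift (f , μ)) i               ≡⟨ co-lincomb (toList f) μ m′ i ⟩
        co (toList f) i ⊕ μ · co m′ i     ≡⟨ cong₂ (λ a b → a ⊕ μ · b) (co-toList-≥ f i (<⇒≤ 2+d≤i))
                                                                      (Deg.above≡0 deg′ i 2+d≤i) ⟩
        0# ⊕ μ · 0#                       ≡⟨ 0+μ0≡0 μ ⟩
        0#                                ∎
        where open ≡-Reasoning

      injective : ∀ {x y} → vec x ≡ vec y → x ≡ y
      injective {f , μ} {f′ , μ′} vx≡vy
        with lincomb-injective deg′ f f′ μ μ′
               (sameVector⇒~ (lift (f , μ)) (lift (f′ , μ′)) (vec~ (f , μ)) (vec~ (f′ , μ′)) vx≡vy)
      ... | f≡f′ , μ≡μ′ = cong₂ _,_ f≡f′ μ≡μ′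

      oneBadScalarPerRow : ∀ {f μ μ′} → f ∈ L′ → μ ∈ elements → μ′ ∈ elements →
                ¬ Admissible (f , μ) → ¬ Admissible (f , μ′) → μ ≡ μ′
      oneBadScalarPerRow {f} {μ} {μ′} f∈ _ _ bad bad′ =
        affineRoot-unique (relPrime-constTerm {toList f} {m′} (proj₂ (good′ f∈)))
                          (root μ bad) (root μ′ bad′)
        where
          root : ∀ ν → ¬ Admissible (f , ν) → co (toList f) 0 ⊕ ν · co m′ 0 ≡ 0#
          root ν bad = trans (sym (co-lincomb (toList f) ν m′ 0))
                             (decidable-stable (co (lift (f , ν)) 0 ≟ 0#) bad)

      good : ∀ {v} → v ∈ map vec pairs → NonZeroV v × RelPrime (toList v) m
      good v∈ with ∈-map⁻ vec v∈
      ... | (f , μ) , fμ∈ , refl with ∈-filter⁻ admissible? fμ∈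
      ... | fμ∈grid , admissible =
        nonZeroV (vec (f , μ)) 0 (λ v₀≡0 → admissible (trans (sym (vec~ (f , μ) 0)) v₀≡0)) ,
        relPrime-respˡ {lift (f , μ)} {toList (vec (f , μ))} {m}
          (relPrime-lincomb-shift {toList f} {m} {m′} μ (~shift-tl {m} m0≡0)
                                  (proj₂ (good′ f∈L′)) admissible)
          (λ i → sym (vec~ (f , μ) i))
        where f∈L′ = proj₁ (∈-cartesianProduct⁻ L′ elements fμ∈grid)

      large : (q ∸ 1) * (2 + d) ≤ length (map vec pairs)
      large = begin
        (q ∸ 1) * (2 + d)          ≤⟨ growth d (∸-monoˡ-≤ 1 q>2) ⟩
        (q ∸ 1) * suc d * (q ∸ 1)  ≤⟨ *-monoˡ-≤ (q ∸ 1) (Family.large family′) ⟩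
        length L′ * (q ∸ 1)        ≤⟨ filter-grid-count admissible? L′ unique oneBadScalarPerRow ⟩
        length pairs               ≡⟨ sym (length-map vec pairs) ⟩
        length (map vec pairs)     ∎
        where open ≤-Reasoning

  family : 2 < q → ∀ d m → Deg m (suc d) → Family m (suc d)
  family q>2 d m deg with co m 0 ≟ 0#
  ... | no m0≢0 = monomialFamily (suc d) λ j c≢0 _ → relPrime-monomial {m = m} j c≢0 m0≢0
  family q>2 zero    m deg | yes _    = monomialFamily 1 λ
    { zero    c≢0 _        → relPrime-const {m = m} c≢0
    ; (suc _) _   (s≤s ()) }
  family q>2 (suc d) m deg | yes m0≡0 = liftFamily q>2 deg m0≡0 (family q>2 d (tl m) (Deg-tl deg))

lemma4p1 : (K : FiniteField) → 2 < FiniteField.q K →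
    (m : Poly.Pol K) (d : ℕ) (hd : Poly.HasDegree K m d) → 1 ≤ d →
    (n : ℕ) → Poly.PhiIs K m d hd n →
    (FiniteField.q K ∸ 1) * d ≤ n
lemma4p1 K q>2 m (suc d) hd (s≤s z≤n) n (L , _ , length≡n , L-complete) = begin
  (FiniteField.q K ∸ 1) * suc d  ≤⟨ Family.large G ⟩
  length (Family.members G)      ≤⟨ unique-⊆⇒length≤ (Family.distinct G) G⊆L ⟩
  length L                       ≡⟨ length≡n ⟩
  n                              ∎
  where
    open ≤-Reasoning
    G : Family K m (suc d)
    G = family K q>2 d m (HasDegree⇒Deg K m (suc d) hd)
    G⊆L : ∀ {v} → v ∈ Family.members G → v ∈ L
    G⊆L v∈G = proj₂ (L-complete _) (Family.good G v∈G)
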